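{- Let $\boldsymbol{k}=(k_1,\dots,k_r)$ be an index and $\boldsymbol{x}=(x_1,\dots,x_r)$ a tuple of indeterminates, and put $x_{r+1}\coloneqq 1$. Then for every positive integer $N$, \[ \sum_{0<n_1<\cdots<n_r<N}\frac{1}{n_1^{k_1}\cdots n_r^{k_r}}\prod_{i=1}^{r}\frac{\binom{Nx_{i+1}-1}{n_i}}{\binom{Nx_i-1}{n_i}} =(-1)^r\sum_{\substack{0< n_{j,1}\leq\cdots\leq n_{j,k_j}< N \ (1\leq j\leq r)\\ n_{j,k_j}<n_{j+1,1} \ (1\leq j<r)}}\prod_{j=1}^r\frac{1}{(n_{j,1}-Nx_j)n_{j,2}\cdots n_{j,k_j}}, \] where the sum on the right runs over integers $n_{j,l}$ ($1\le j\le r$, $1\le l\le k_j$). This is an identity of rational functions in $x_1,\dots,x_r$.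
   Context: An index is a tuple $(k_1,\dots,k_r)$ of positive integers. For an indeterminate (or number) $x$ and a non-negative integer $n$, $\binom{x}{n}\coloneqq\frac{x(x-1)\cdots(x-n+1)}{n!}$ for $n\ge1$ and $\binom{x}{0}\coloneqq1$. -}

module Defs where

open import Data.Nat as ℕ using (ℕ; zero; suc; _∸_)
open import Data.Integer using (+_)
open import Data.Rational using (ℚ; 0ℚ; 1ℚ; _+_; _*_; _-_; -_; 1/_; _/_; ≢-nonZero)
open import Data.Rational.Properties using (_≟_)
open import Data.List using (List; []; _∷_; map; upTo; concatMap)
open import Data.Vec using (Vec; []; _∷_)
open import Relation.Nullary using (yes; no)

ι : ℕ → ℚ
ι n = (+ n) / 1

-- total inverse (inv 0 = 0); only ever applied where the statement's
-- hypotheses guarantee a nonzero argument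
inv : ℚ → ℚ
inv q with q ≟ 0ℚ
... | yes _  = 0ℚ
... | no q≢0 = 1/_ q {{≢-nonZero q≢0}}

_÷'_ : ℚ → ℚ → ℚ
p ÷' q = p * inv q

pow : ℚ → ℕ → ℚ
pow q zero    = 1ℚ
pow q (suc n) = q * pow q n

sumL : List ℚ → ℚ
sumL []       = 0ℚ
sumL (q ∷ qs) = q + sumL qs

falling : ℚ → ℕ → ℚ
falling y zero    = 1ℚ
falling y (suc n) = falling y n * (y - ι n)

fact : ℕ → ℕ
fact zero    = 1
fact (suc n) = suc n ℕ.* fact n

binom : ℚ → ℕ → ℚ
binom y n = falling y n ÷' ι (fact n)

range : ℕ → ℕ → List ℕ
range a N = map (a ℕ.+_) (upTo (N ∸ a))

-- Left-hand side.
-- lhsSum N k x lo = sum over lo ≤ n_1 < n_2 < ... < n_r < N of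
--   prod_i  1/n_i^{k_i} * binom(N x_{i+1} - 1, n_i) / binom(N x_i - 1, n_i),
-- where x_{r+1} := 1 (x_{i+1} is the head of the remaining vector, or 1).

headOr1 : {r : ℕ} → Vec ℚ r → ℚ
headOr1 []      = 1ℚ
headOr1 (y ∷ _) = y

lhsSum : (N : ℕ) {r : ℕ} → Vec ℕ r → Vec ℚ r → ℕ → ℚ
lhsSum N []       []       lo = 1ℚ
lhsSum N (k ∷ ks) (x ∷ xs) lo =
  sumL (map (λ n →
      (inv (pow (ι n) k)
        * (binom (ι N * headOr1 xs - 1ℚ) n ÷' binom (ι N * x - 1ℚ) n))
      * lhsSum N ks xs (suc n))
    (range lo N))

LHS : (N : ℕ) {r : ℕ} → Vec ℕ r → Vec ℚ r → ℚ
LHS N k x = lhsSum N k x 1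

weakSeqs : ℕ → ℕ → ℕ → List (List ℕ)
weakSeqs zero    lo N = [] ∷ []
weakSeqs (suc k) lo N =
  concatMap (λ n → map (n ∷_) (weakSeqs k n N)) (range lo N)

lastOr : ℕ → List ℕ → ℕ
lastOr d []       = d
lastOr d (n ∷ ns) = lastOr n ns

blockTerm : ℕ → ℚ → List ℕ → ℚ
blockTerm N x []       = 1ℚ
blockTerm N x (m ∷ ms) = inv ((ι m - ι N * x) * prodN ms)
  where
  prodN : List ℕ → ℚ
  prodN []       = 1ℚ
  prodN (a ∷ as) = ι a * prodN as

-- rhsSum N k x lo = sum over blocks (n_{j,1} ≤ ... ≤ n_{j,k_j}) for j = 1..r,
-- with lo ≤ n_{1,1}, all entries < N and n_{j,k_j} < n_{j+1,1},
-- of prod_j 1/((n_{j,1} - N x_j) n_{j,2} ... n_{j,k_j}).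
rhsSum : (N : ℕ) {r : ℕ} → Vec ℕ r → Vec ℚ r → ℕ → ℚ
rhsSum N []       []       lo = 1ℚ
rhsSum N (k ∷ ks) (x ∷ xs) lo =
  sumL (map (λ b → blockTerm N x b * rhsSum N ks xs (suc (lastOr lo b)))
    (weakSeqs k lo N))

RHS : (N : ℕ) {r : ℕ} → Vec ℕ r → Vec ℚ r → ℚ
RHS N {r} k x = pow (- 1ℚ) r * rhsSum N k x 1

-- Write a = N x₁, y = a - 1, and C(q-1, p-1) for the number of compositions of q into p parts.
-- Induction on r proves the stronger identity
--   binom(N x₁ - 1, p) · Σ_{p < n₁ < ⋯ < n_r < N} (…) = (-1)^r Σ_{p ≤ q < N} C(q-1, p-1) · Σ_{q < n_{1,1} ≤ ⋯} (…),
-- whose case p = 0 is the theorem and whose case r = 0 is the hockey-stick identity.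
-- In the inductive step the factor 1/n^(k₁-1) is moved through the weights C(q-1, n-1) by
-- C(q-1, n-1)/n = C(q, n)/q, which turns it into the k₁-1 nested sums over n_{1,2} ≤ ⋯ ≤ n_{1,k₁};
-- the remaining weight binom(y, p)/(n binom(y, n)) is summed over p < n ≤ q by the telescoping
-- partial-fraction identity
--   Σ_{p < n ≤ q} C(q-1, n-1)/(n binom(y, n)) = C(q-1, p)/(binom(y, p) (a - q)),
-- which produces the factor 1/(n_{1,1} - N x₁) together with one more sign.

module Submission where

open import Defs
open import Data.Vec using (Vec; []; _∷_; lookup)
open import Data.Vec.Relation.Unary.All using (All; []; _∷_)
open import Data.Fin using (Fin; zero; suc)
open import Data.Nat as ℕ using (ℕ; zero; suc; _∸_; z≤n; s≤s; _<_; _≤_; _≤′_; ≤′-refl; ≤′-step)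
import Data.Nat.Properties as ℕ
import Data.Integer as ℤ
import Data.Integer.Properties as ℤ
open import Data.Rational using (ℚ; 0ℚ; 1ℚ; _+_; _*_; _-_; -_; toℚᵘ; ≢-nonZero)
open import Data.Rational.Properties
import Data.Rational.Unnormalised as ℚᵘ
import Data.Rational.Unnormalised.Properties as ℚᵘ
open import Data.Rational.Solver using (module +-*-Solver)
open import Data.List using (List; []; _∷_; _++_; map; upTo; applyUpTo; concatMap)
open import Data.List.Properties using (map-∘; map-applyUpTo; map-++; map-cong)
open import Data.Sum using (inj₁; inj₂)
open import Function using (_∘_; id)
open import Relation.Nullary using (Dec; yes; no; contradiction)
open import Relation.Binary.PropositionalEquality

open +-*-Solver
open ≡-Reasoning

inv-inverseˡ : ∀ {q} → q ≢ 0ℚ → inv q * q ≡ 1ℚ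
inv-inverseˡ {q} q≢0 with q ≟ 0ℚ
... | yes q≡0 = contradiction q≡0 q≢0
... | no  q≢0 = *-inverseˡ q {{≢-nonZero q≢0}}

inv-inverseʳ : ∀ {q} → q ≢ 0ℚ → q * inv q ≡ 1ℚ
inv-inverseʳ {q} q≢0 = trans (*-comm q (inv q)) (inv-inverseˡ q≢0)

inv-unique : ∀ p q → p * q ≡ 1ℚ → inv p ≡ q
inv-unique p q pq≡1 = begin
  inv p           ≡⟨ sym (*-identityʳ (inv p)) ⟩
  inv p * 1ℚ      ≡⟨ cong (inv p *_) pq≡1 ⟨
  inv p * (p * q) ≡⟨ *-assoc (inv p) p q ⟨
  inv p * p * q   ≡⟨ cong (_* q) (inv-inverseˡ p≢0) ⟩
  1ℚ * q          ≡⟨ *-identityˡ q ⟩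
  q               ∎
  where
  p≢0 : p ≢ 0ℚ
  p≢0 refl = 1≢0 (trans (sym pq≡1) (*-zeroˡ q))

-- Since inv 0ℚ = 0ℚ, inversion is multiplicative without side conditions.
inv-distrib-* : ∀ p q → inv (p * q) ≡ inv p * inv q
inv-distrib-* p q = by-cases (p ≟ 0ℚ) (q ≟ 0ℚ)
  where
  by-cases : Dec (p ≡ 0ℚ) → Dec (q ≡ 0ℚ) → inv (p * q) ≡ inv p * inv q
  by-cases (yes refl) _          = trans (cong inv (*-zeroˡ q)) (sym (*-zeroˡ (inv q)))
  by-cases (no _)     (yes refl) = trans (cong inv (*-zeroʳ p)) (sym (*-zeroʳ (inv p)))
  by-cases (no p≢0)   (no q≢0)   = inv-unique (p * q) (inv p * inv q) (begin
    p * q * (inv p * inv q) ≡⟨ solve 4 (λ a b c d → a :* b :* (c :* d) := a :* c :* (b :* d)) refl p q (inv p) (inv q) ⟩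
    p * inv p * (q * inv q) ≡⟨ cong₂ _*_ (inv-inverseʳ p≢0) (inv-inverseʳ q≢0) ⟩
    1ℚ                      ∎)

inv-involutive : ∀ q → inv (inv q) ≡ q
inv-involutive q = by-cases (q ≟ 0ℚ)
  where
  by-cases : Dec (q ≡ 0ℚ) → inv (inv q) ≡ q
  by-cases (yes refl) = refl
  by-cases (no q≢0)   = inv-unique (inv q) q (inv-inverseˡ q≢0)

inv-neg : ∀ q → inv (- q) ≡ - inv q
inv-neg q = by-cases (q ≟ 0ℚ)
  where
  by-cases : Dec (q ≡ 0ℚ) → inv (- q) ≡ - inv q
  by-cases (yes refl) = refl
  by-cases (no q≢0)   = inv-unique (- q) (- inv q)
    (trans (solve 2 (λ a b → (:- a) :* (:- b) := a :* b) refl q (inv q)) (inv-inverseʳ q≢0))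

*-≢0 : ∀ {p q} → p ≢ 0ℚ → q ≢ 0ℚ → p * q ≢ 0ℚ
*-≢0 {p} {q} p≢0 q≢0 pq≡0 = 1≢0 (begin
  1ℚ                      ≡⟨ cong₂ _*_ (inv-inverseʳ p≢0) (inv-inverseʳ q≢0) ⟨
  p * inv p * (q * inv q) ≡⟨ solve 4 (λ a b c d → a :* b :* (c :* d) := a :* c :* (b :* d)) refl p (inv p) q (inv q) ⟩
  p * q * (inv p * inv q) ≡⟨ cong (_* (inv p * inv q)) pq≡0 ⟩
  0ℚ * (inv p * inv q)    ≡⟨ *-zeroˡ (inv p * inv q) ⟩
  0ℚ                      ∎)

inv-≢0 : ∀ {q} → q ≢ 0ℚ → inv q ≢ 0ℚ
inv-≢0 {q} q≢0 inv≡0 = 1≢0 (trans (sym (inv-inverseˡ q≢0)) (trans (cong (_* q) inv≡0) (*-zeroˡ q)))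

-≢0 : ∀ {p q} → p ≢ q → p - q ≢ 0ℚ
-≢0 {p} {q} p≢q p-q≡0 = p≢q (begin
  p           ≡⟨ solve 2 (λ p q → p := p :- q :+ q) refl p q ⟩
  p - q + q   ≡⟨ cong (_+ q) p-q≡0 ⟩
  0ℚ + q      ≡⟨ +-identityˡ q ⟩
  q           ∎)

inv-cross : ∀ {p q x y} → p ≢ 0ℚ → q ≢ 0ℚ → p * x ≡ q * y → inv q * x ≡ inv p * y
inv-cross {p} {q} {x} {y} p≢0 q≢0 px≡qy = begin
  inv q * x               ≡⟨ *-identityʳ (inv q * x) ⟨
  inv q * x * 1ℚ          ≡⟨ cong (inv q * x *_) (inv-inverseˡ p≢0) ⟨
  inv q * x * (inv p * p) ≡⟨ solve 4 (λ iq x ip p → iq :* x :* (ip :* p) := ip :* iq :* (p :* x)) refl (inv q) x (inv p) p ⟩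
  inv p * inv q * (p * x) ≡⟨ cong (inv p * inv q *_) px≡qy ⟩
  inv p * inv q * (q * y) ≡⟨ solve 4 (λ ip iq q y → ip :* iq :* (q :* y) := ip :* y :* (iq :* q)) refl (inv p) (inv q) q y ⟩
  inv p * y * (inv q * q) ≡⟨ cong (inv p * y *_) (inv-inverseˡ q≢0) ⟩
  inv p * y * 1ℚ          ≡⟨ *-identityʳ (inv p * y) ⟩
  inv p * y               ∎

ι-as-ℚᵘ : ∀ n → toℚᵘ (ι n) ℚᵘ.≃ ℚᵘ.mkℚᵘ (ℤ.+ n) 0
ι-as-ℚᵘ n = toℚᵘ-fromℚᵘ (ℚᵘ.mkℚᵘ (ℤ.+ n) 0)

ι-+ : ∀ m n → ι (m ℕ.+ n) ≡ ι m + ι n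
ι-+ m n = toℚᵘ-injective (begin-≃
  toℚᵘ (ι (m ℕ.+ n))                        ≈⟨ ι-as-ℚᵘ (m ℕ.+ n) ⟩
  ℚᵘ.mkℚᵘ (ℤ.+ (m ℕ.+ n)) 0                 ≈⟨ ℚᵘ.*≡* (cong (ℤ._* (ℤ.+ 1)) numerator) ⟩
  ℚᵘ.mkℚᵘ (ℤ.+ m) 0 ℚᵘ.+ ℚᵘ.mkℚᵘ (ℤ.+ n) 0  ≈⟨ ℚᵘ.+-cong (ι-as-ℚᵘ m) (ι-as-ℚᵘ n) ⟨
  toℚᵘ (ι m) ℚᵘ.+ toℚᵘ (ι n)                ≈⟨ toℚᵘ-homo-+ (ι m) (ι n) ⟨
  toℚᵘ (ι m + ι n)                          ≃∎)
  where
  open ℚᵘ.≃-Reasoning renaming (begin_ to begin-≃_; _∎ to _≃∎)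
  numerator : ℤ.+ (m ℕ.+ n) ≡ (ℤ.+ m) ℤ.* (ℤ.+ 1) ℤ.+ (ℤ.+ n) ℤ.* (ℤ.+ 1)
  numerator = trans (ℤ.pos-+ m n) (sym (cong₂ ℤ._+_ (ℤ.*-identityʳ (ℤ.+ m)) (ℤ.*-identityʳ (ℤ.+ n))))

ι-* : ∀ m n → ι (m ℕ.* n) ≡ ι m * ι n
ι-* m n = toℚᵘ-injective (begin-≃
  toℚᵘ (ι (m ℕ.* n))                        ≈⟨ ι-as-ℚᵘ (m ℕ.* n) ⟩
  ℚᵘ.mkℚᵘ (ℤ.+ (m ℕ.* n)) 0                 ≈⟨ ℚᵘ.*≡* (cong (ℤ._* (ℤ.+ 1)) (ℤ.pos-* m n)) ⟩
  ℚᵘ.mkℚᵘ (ℤ.+ m) 0 ℚᵘ.* ℚᵘ.mkℚᵘ (ℤ.+ n) 0  ≈⟨ ℚᵘ.*-cong (ι-as-ℚᵘ m) (ι-as-ℚᵘ n) ⟨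
  toℚᵘ (ι m) ℚᵘ.* toℚᵘ (ι n)                ≈⟨ toℚᵘ-homo-* (ι m) (ι n) ⟨
  toℚᵘ (ι m * ι n)                          ≃∎)
  where open ℚᵘ.≃-Reasoning renaming (begin_ to begin-≃_; _∎ to _≃∎)

ι-suc : ∀ n → ι (suc n) ≡ 1ℚ + ι n
ι-suc = ι-+ 1

ι-suc≢0 : ∀ n → ι (suc n) ≢ 0ℚ
ι-suc≢0 n ι≡0 = <-irrefl (sym ι≡0) (positive⁻¹ (ι (suc n)) {{normalize-pos (suc n) 1}})

ι-≢0 : ∀ {n} → 0 < n → ι n ≢ 0ℚ
ι-≢0 {suc n} _ = ι-suc≢0 n

sumL-++ : ∀ xs ys → sumL (xs ++ ys) ≡ sumL xs + sumL ys
sumL-++ []       ys = sym (+-identityˡ (sumL ys))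
sumL-++ (x ∷ xs) ys = trans (cong (x +_) (sumL-++ xs ys)) (sym (+-assoc x (sumL xs) (sumL ys)))

sumL-concatMap : ∀ {A B : Set} (f : B → ℚ) (g : A → List B) xs →
  sumL (map f (concatMap g xs)) ≡ sumL (map (λ x → sumL (map f (g x))) xs)
sumL-concatMap f g []       = refl
sumL-concatMap f g (x ∷ xs) = begin
  sumL (map f (g x ++ concatMap g xs))                ≡⟨ cong sumL (map-++ f (g x) (concatMap g xs)) ⟩
  sumL (map f (g x) ++ map f (concatMap g xs))        ≡⟨ sumL-++ (map f (g x)) (map f (concatMap g xs)) ⟩
  sumL (map f (g x)) + sumL (map f (concatMap g xs))  ≡⟨ cong (sumL (map f (g x)) +_) (sumL-concatMap f g xs) ⟩
  sumL (map (λ x → sumL (map f (g x))) (x ∷ xs))      ∎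

*-distribˡ-sumL : ∀ {A : Set} c (f : A → ℚ) xs → c * sumL (map f xs) ≡ sumL (map (λ x → c * f x) xs)
*-distribˡ-sumL c f []       = *-zeroʳ c
*-distribˡ-sumL c f (x ∷ xs) = trans (*-distribˡ-+ c (f x) _) (cong (c * f x +_) (*-distribˡ-sumL c f xs))

-- ∑ is opaque so that its bounds and summand can be recovered by unification.
opaque
  sumFrom : ℕ → ℕ → (ℕ → ℚ) → ℚ
  sumFrom lo zero    f = 0ℚ
  sumFrom lo (suc d) f = f lo + sumFrom (suc lo) d f

  ∑ : ℕ → ℕ → (ℕ → ℚ) → ℚ
  ∑ lo hi f = sumFrom lo (hi ∸ lo) f

  syntax ∑ lo hi (λ i → e) = ∑[ lo ≤ i < hi ] e

  sumL-applyUpTo : ∀ {f g : ℕ → ℚ} d lo → (∀ i → g i ≡ f (lo ℕ.+ i)) → sumL (applyUpTo g d) ≡ sumFrom lo d f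
  sumL-applyUpTo         zero    lo g≗f = refl
  sumL-applyUpTo {f} {g} (suc d) lo g≗f = cong₂ _+_
    (trans (g≗f 0) (cong f (ℕ.+-identityʳ lo)))
    (sumL-applyUpTo d (suc lo) (λ i → trans (g≗f (suc i)) (cong f (ℕ.+-suc lo i))))

  sumL-range : ∀ lo hi f → sumL (map f (range lo hi)) ≡ ∑ lo hi f
  sumL-range lo hi f = begin
    sumL (map f (map (lo ℕ.+_) (upTo (hi ∸ lo)))) ≡⟨ cong sumL (map-∘ (upTo (hi ∸ lo))) ⟨
    sumL (map (f ∘ (lo ℕ.+_)) (upTo (hi ∸ lo)))   ≡⟨ cong sumL (map-applyUpTo id (f ∘ (lo ℕ.+_)) (hi ∸ lo)) ⟩
    sumL (applyUpTo (f ∘ (lo ℕ.+_)) (hi ∸ lo))    ≡⟨ sumL-applyUpTo (hi ∸ lo) lo (λ _ → refl) ⟩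
    ∑ lo hi f                                     ∎

  ∑-empty : ∀ {f lo hi} → hi ≤ lo → ∑ lo hi f ≡ 0ℚ
  ∑-empty hi≤lo rewrite ℕ.m≤n⇒m∸n≡0 hi≤lo = refl

  ∑-head : ∀ {f lo hi} → lo < hi → ∑ lo hi f ≡ f lo + ∑ (suc lo) hi f
  ∑-head {lo = lo} {suc hi} (s≤s lo≤hi) rewrite ℕ.+-∸-assoc 1 lo≤hi = refl

  sumFrom-last : ∀ {f} lo d → sumFrom lo (suc d) f ≡ sumFrom lo d f + f (lo ℕ.+ d)
  sumFrom-last {f} lo zero    = trans (+-comm (f lo) 0ℚ) (cong (λ i → 0ℚ + f i) (sym (ℕ.+-identityʳ lo)))
  sumFrom-last {f} lo (suc d) = begin
    f lo + sumFrom (suc lo) (suc d) f              ≡⟨ cong (f lo +_) (sumFrom-last (suc lo) d) ⟩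
    f lo + (sumFrom (suc lo) d f + f (suc lo ℕ.+ d)) ≡⟨ +-assoc (f lo) _ _ ⟨
    f lo + sumFrom (suc lo) d f + f (suc lo ℕ.+ d) ≡⟨ cong (λ i → f lo + sumFrom (suc lo) d f + f i) (ℕ.+-suc lo d) ⟨
    f lo + sumFrom (suc lo) d f + f (lo ℕ.+ suc d) ∎

  ∑-last : ∀ {f lo hi} → lo ≤ hi → ∑ lo (suc hi) f ≡ ∑ lo hi f + f hi
  ∑-last {f} {lo} {hi} lo≤hi rewrite ℕ.+-∸-assoc 1 lo≤hi =
    trans (sumFrom-last lo (hi ∸ lo)) (cong (λ i → ∑ lo hi f + f i) (ℕ.m+[n∸m]≡n lo≤hi))

  sumFrom-cong : ∀ {f g} lo d → (∀ i → lo ≤ i → i < lo ℕ.+ d → f i ≡ g i) → sumFrom lo d f ≡ sumFrom lo d g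
  sumFrom-cong lo zero    f≗g = refl
  sumFrom-cong lo (suc d) f≗g = cong₂ _+_
    (f≗g lo ℕ.≤-refl (ℕ.m<m+n lo (s≤s z≤n)))
    (sumFrom-cong (suc lo) d (λ i lo<i i<lo+1+d → f≗g i (ℕ.<⇒≤ lo<i) (subst (i <_) (sym (ℕ.+-suc lo d)) i<lo+1+d)))

  ∑-cong : ∀ {f g} lo hi → (∀ i → lo ≤ i → i < hi → f i ≡ g i) → ∑ lo hi f ≡ ∑ lo hi g
  ∑-cong lo hi f≗g with ℕ.≤-total lo hi
  ... | inj₁ lo≤hi = sumFrom-cong lo (hi ∸ lo) (λ i lo≤i i<hi → f≗g i lo≤i (subst (i <_) (ℕ.m+[n∸m]≡n lo≤hi) i<hi))
  ... | inj₂ hi≤lo = trans (∑-empty hi≤lo) (sym (∑-empty hi≤lo))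

  ∑-zero : ∀ {f} lo hi → (∀ i → lo ≤ i → i < hi → f i ≡ 0ℚ) → ∑ lo hi f ≡ 0ℚ
  ∑-zero {f} lo hi f≗0 = trans (∑-cong lo hi f≗0) (zeros (hi ∸ lo) lo)
    where
    zeros : ∀ d lo → sumFrom lo d (λ _ → 0ℚ) ≡ 0ℚ
    zeros zero    lo = refl
    zeros (suc d) lo = trans (+-identityˡ _) (zeros d (suc lo))

  *-distribˡ-∑ : ∀ c f lo hi → c * ∑ lo hi f ≡ ∑[ lo ≤ i < hi ] (c * f i)
  *-distribˡ-∑ c f lo hi = go lo (hi ∸ lo)
    where
    go : ∀ lo d → c * sumFrom lo d f ≡ sumFrom lo d (λ i → c * f i)
    go lo zero    = *-zeroʳ c
    go lo (suc d) = trans (*-distribˡ-+ c (f lo) _) (cong (c * f lo +_) (go (suc lo) d))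

  ∑-distrib-+ : ∀ f g lo hi → ∑[ lo ≤ i < hi ] (f i + g i) ≡ ∑ lo hi f + ∑ lo hi g
  ∑-distrib-+ f g lo hi = go lo (hi ∸ lo)
    where
    go : ∀ lo d → sumFrom lo d (λ i → f i + g i) ≡ sumFrom lo d f + sumFrom lo d g
    go lo zero    = refl
    go lo (suc d) = trans (cong (f lo + g lo +_) (go (suc lo) d))
      (solve 4 (λ a b c d → a :+ b :+ (c :+ d) := a :+ c :+ (b :+ d)) refl (f lo) (g lo) (sumFrom (suc lo) d f) (sumFrom (suc lo) d g))

∑-swap-≤ : ∀ (F : ℕ → ℕ → ℚ) a hi →
  ∑[ a ≤ i < hi ] ∑[ i ≤ j < hi ] F i j ≡ ∑[ a ≤ j < hi ] ∑[ a ≤ i < suc j ] F i j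
∑-swap-≤ F a zero     = trans (∑-empty z≤n) (sym (∑-empty z≤n))
∑-swap-≤ F a (suc hi) with ℕ.≤-<-connex a hi
... | inj₂ hi<a = trans (∑-empty hi<a) (sym (∑-empty hi<a))
... | inj₁ a≤hi = begin
  ∑[ a ≤ i < suc hi ] ∑[ i ≤ j < suc hi ] F i j
    ≡⟨ ∑-cong a (suc hi) (λ i _ i≤hi → ∑-last (ℕ.≤-pred i≤hi)) ⟩
  ∑[ a ≤ i < suc hi ] (∑[ i ≤ j < hi ] F i j + F i hi)
    ≡⟨ ∑-distrib-+ _ _ a (suc hi) ⟩
  ∑[ a ≤ i < suc hi ] ∑[ i ≤ j < hi ] F i j + new
    ≡⟨ cong (_+ new) (∑-last a≤hi) ⟩
  ∑[ a ≤ i < hi ] ∑[ i ≤ j < hi ] F i j + ∑[ hi ≤ j < hi ] F hi j + new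
    ≡⟨ cong (λ x → ∑[ a ≤ i < hi ] ∑[ i ≤ j < hi ] F i j + x + new) (∑-empty ℕ.≤-refl) ⟩
  ∑[ a ≤ i < hi ] ∑[ i ≤ j < hi ] F i j + 0ℚ + new
    ≡⟨ cong (_+ new) (trans (+-identityʳ _) (∑-swap-≤ F a hi)) ⟩
  ∑[ a ≤ j < hi ] ∑[ a ≤ i < suc j ] F i j + new
    ≡⟨ ∑-last a≤hi ⟨
  ∑[ a ≤ j < suc hi ] ∑[ a ≤ i < suc j ] F i j
    ∎
  where
  new : ℚ
  new = ∑[ a ≤ i < suc hi ] F i hi

∑-swap-< : ∀ (F : ℕ → ℕ → ℚ) a hi →
  ∑[ a ≤ i < hi ] ∑[ suc i ≤ j < hi ] F i j ≡ ∑[ suc a ≤ j < hi ] ∑[ a ≤ i < j ] F i j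
∑-swap-< F a zero     = trans (∑-empty z≤n) (sym (∑-empty z≤n))
∑-swap-< F a (suc hi) with ℕ.<-≤-connex a hi
... | inj₂ hi≤a = trans (∑-zero a (suc hi) (λ i a≤i _ → ∑-empty (s≤s (ℕ.≤-trans hi≤a a≤i)))) (sym (∑-empty (s≤s hi≤a)))
... | inj₁ a<hi = begin
  ∑[ a ≤ i < suc hi ] ∑[ suc i ≤ j < suc hi ] F i j
    ≡⟨ ∑-last (ℕ.<⇒≤ a<hi) ⟩
  ∑[ a ≤ i < hi ] ∑[ suc i ≤ j < suc hi ] F i j + ∑[ suc hi ≤ j < suc hi ] F hi j
    ≡⟨ trans (cong (∑[ a ≤ i < hi ] ∑[ suc i ≤ j < suc hi ] F i j +_) (∑-empty ℕ.≤-refl)) (+-identityʳ _) ⟩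
  ∑[ a ≤ i < hi ] ∑[ suc i ≤ j < suc hi ] F i j
    ≡⟨ ∑-cong a hi (λ i _ i<hi → ∑-last i<hi) ⟩
  ∑[ a ≤ i < hi ] (∑[ suc i ≤ j < hi ] F i j + F i hi)
    ≡⟨ ∑-distrib-+ _ _ a hi ⟩
  ∑[ a ≤ i < hi ] ∑[ suc i ≤ j < hi ] F i j + ∑[ a ≤ i < hi ] F i hi
    ≡⟨ cong (_+ ∑[ a ≤ i < hi ] F i hi) (∑-swap-< F a hi) ⟩
  ∑[ suc a ≤ j < hi ] ∑[ a ≤ i < j ] F i j + ∑[ a ≤ i < hi ] F i hi
    ≡⟨ ∑-last a<hi ⟨
  ∑[ suc a ≤ j < suc hi ] ∑[ a ≤ i < j ] F i j
    ∎

∑-telescope : ∀ {t f : ℕ → ℚ} lo hi → lo ≤ hi → (∀ n → lo ≤ n → n < hi → t (suc n) + f (suc n) ≡ f n) →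
  ∑[ suc lo ≤ n < suc hi ] t n + f hi ≡ f lo
∑-telescope {t} {f} lo _ = go ∘ ℕ.≤⇒≤′
  where
  go : ∀ {hi} → lo ≤′ hi → (∀ n → lo ≤ n → n < hi → t (suc n) + f (suc n) ≡ f n) →
    ∑[ suc lo ≤ n < suc hi ] t n + f hi ≡ f lo
  go ≤′-refl _ = trans (cong (_+ f lo) (∑-empty ℕ.≤-refl)) (+-identityˡ (f lo))
  go {suc hi} (≤′-step lo≤′hi) step = begin
    ∑[ suc lo ≤ n < suc (suc hi) ] t n + f (suc hi)       ≡⟨ cong (_+ f (suc hi)) (∑-last (s≤s lo≤hi)) ⟩
    ∑[ suc lo ≤ n < suc hi ] t n + t (suc hi) + f (suc hi) ≡⟨ +-assoc (∑[ suc lo ≤ n < suc hi ] t n) _ _ ⟩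
    ∑[ suc lo ≤ n < suc hi ] t n + (t (suc hi) + f (suc hi)) ≡⟨ cong (∑[ suc lo ≤ n < suc hi ] t n +_) (step hi lo≤hi ℕ.≤-refl) ⟩
    ∑[ suc lo ≤ n < suc hi ] t n + f hi                    ≡⟨ go lo≤′hi (λ n lo≤n n<hi → step n lo≤n (ℕ.m<n⇒m<1+n n<hi)) ⟩
    f lo                                                   ∎
    where
    lo≤hi : lo ≤ hi
    lo≤hi = ℕ.≤′⇒≤ lo≤′hi

falling-vanishes : ∀ q p → q < p → falling (ι q) p ≡ 0ℚ
falling-vanishes q (suc p) (s≤s q≤p) with ℕ.m≤n⇒m<n∨m≡n q≤p
... | inj₁ q<p  = trans (cong (_* (ι q - ι p)) (falling-vanishes q p q<p)) (*-zeroˡ (ι q - ι p))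
... | inj₂ refl = trans (cong (falling (ι q) q *_) (+-inverseʳ (ι q))) (*-zeroʳ (falling (ι q) q))

falling-absorb : ∀ y p → falling (1ℚ + y) (suc p) ≡ (1ℚ + y) * falling y p
falling-absorb y zero    = solve 1 (λ y → con 1ℚ :* (con 1ℚ :+ y :- con 0ℚ) := (con 1ℚ :+ y) :* con 1ℚ) refl y
falling-absorb y (suc p) = begin
  falling (1ℚ + y) (suc p) * (1ℚ + y - ι (suc p))   ≡⟨ cong₂ (λ u v → u * (1ℚ + y - v)) (falling-absorb y p) (ι-suc p) ⟩
  (1ℚ + y) * falling y p * (1ℚ + y - (1ℚ + ι p))   ≡⟨ solve 3 (λ y F u → (con 1ℚ :+ y) :* F :* (con 1ℚ :+ y :- (con 1ℚ :+ u)) := (con 1ℚ :+ y) :* (F :* (y :- u))) refl y (falling y p) (ι p) ⟩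
  (1ℚ + y) * (falling y p * (y - ι p))             ∎

falling-pascal : ∀ y p → falling (1ℚ + y) (suc p) ≡ falling y (suc p) + ι (suc p) * falling y p
falling-pascal y zero    = solve 1 (λ y → con 1ℚ :* (con 1ℚ :+ y :- con 0ℚ) := con 1ℚ :* (y :- con 0ℚ) :+ con 1ℚ :* con 1ℚ) refl y
falling-pascal y (suc p) = begin
  falling (1ℚ + y) (suc p) * (1ℚ + y - ι (suc p))
    ≡⟨ cong₂ (λ u v → u * (1ℚ + y - v)) (falling-pascal y p) (ι-suc p) ⟩
  (falling y p * (y - ι p) + ι (suc p) * falling y p) * (1ℚ + y - (1ℚ + ι p))
    ≡⟨ cong (λ v → (falling y p * (y - ι p) + v * falling y p) * (1ℚ + y - (1ℚ + ι p))) (ι-suc p) ⟩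
  (falling y p * (y - ι p) + (1ℚ + ι p) * falling y p) * (1ℚ + y - (1ℚ + ι p))
    ≡⟨ solve 3 (λ y F u → (F :* (y :- u) :+ (con 1ℚ :+ u) :* F) :* (con 1ℚ :+ y :- (con 1ℚ :+ u))
                        := F :* (y :- u) :* (y :- (con 1ℚ :+ u)) :+ (con 1ℚ :+ (con 1ℚ :+ u)) :* (F :* (y :- u))) refl y (falling y p) (ι p) ⟩
  falling y p * (y - ι p) * (y - (1ℚ + ι p)) + (1ℚ + (1ℚ + ι p)) * (falling y p * (y - ι p))
    ≡⟨ cong₂ (λ u v → falling y p * (y - ι p) * (y - u) + v * (falling y p * (y - ι p))) (ι-suc p) (trans (ι-suc (suc p)) (cong (1ℚ +_) (ι-suc p))) ⟨
  falling y p * (y - ι p) * (y - ι (suc p)) + ι (suc (suc p)) * (falling y p * (y - ι p))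
    ∎

inv-ι-fact-suc : ∀ p → inv (ι (fact (suc p))) ≡ inv (ι (suc p)) * inv (ι (fact p))
inv-ι-fact-suc p = trans (cong inv (ι-* (suc p) (fact p))) (inv-distrib-* (ι (suc p)) (ι (fact p)))

binom-suc : ∀ y p → binom y (suc p) ≡ binom y p * (y - ι p) * inv (ι (suc p))
binom-suc y p = begin
  falling y p * (y - ι p) * inv (ι (fact (suc p)))                    ≡⟨ cong (falling y p * (y - ι p) *_) (inv-ι-fact-suc p) ⟩
  falling y p * (y - ι p) * (inv (ι (suc p)) * inv (ι (fact p)))      ≡⟨ solve 4 (λ F u s f → F :* u :* (s :* f) := F :* f :* u :* s) refl (falling y p) (y - ι p) (inv (ι (suc p))) (inv (ι (fact p))) ⟩
  falling y p * inv (ι (fact p)) * (y - ι p) * inv (ι (suc p))        ∎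

binom-suc′ : ∀ y p → ι (suc p) * binom y (suc p) ≡ binom y p * (y - ι p)
binom-suc′ y p = begin
  ι (suc p) * binom y (suc p)                                  ≡⟨ cong (ι (suc p) *_) (binom-suc y p) ⟩
  ι (suc p) * (binom y p * (y - ι p) * inv (ι (suc p)))        ≡⟨ solve 4 (λ s b u is → s :* (b :* u :* is) := b :* u :* (s :* is)) refl (ι (suc p)) (binom y p) (y - ι p) (inv (ι (suc p))) ⟩
  binom y p * (y - ι p) * (ι (suc p) * inv (ι (suc p)))        ≡⟨ cong (binom y p * (y - ι p) *_) (inv-inverseʳ (ι-suc≢0 p)) ⟩
  binom y p * (y - ι p) * 1ℚ                                   ≡⟨ *-identityʳ _ ⟩
  binom y p * (y - ι p)                                        ∎

inv-binom-suc : ∀ y p → inv (binom y (suc p)) ≡ inv (binom y p) * ι (suc p) * inv (y - ι p)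
inv-binom-suc y p = begin
  inv (binom y (suc p))                                        ≡⟨ cong inv (binom-suc y p) ⟩
  inv (binom y p * (y - ι p) * inv (ι (suc p)))                ≡⟨ inv-distrib-* (binom y p * (y - ι p)) _ ⟩
  inv (binom y p * (y - ι p)) * inv (inv (ι (suc p)))          ≡⟨ cong₂ _*_ (inv-distrib-* (binom y p) (y - ι p)) (inv-involutive (ι (suc p))) ⟩
  inv (binom y p) * inv (y - ι p) * ι (suc p)                  ≡⟨ solve 3 (λ b u s → b :* u :* s := b :* s :* u) refl (inv (binom y p)) (inv (y - ι p)) (ι (suc p)) ⟩
  inv (binom y p) * ι (suc p) * inv (y - ι p)                  ∎

binom-vanishes : ∀ q p → q < p → binom (ι q) p ≡ 0ℚ
binom-vanishes q p q<p = trans (cong (_* inv (ι (fact p))) (falling-vanishes q p q<p)) (*-zeroˡ (inv (ι (fact p))))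

binom-≢0 : ∀ y p → (∀ i → i < p → y - ι i ≢ 0ℚ) → binom y p ≢ 0ℚ
binom-≢0 y zero    _      = 1≢0
binom-≢0 y (suc p) y≢ι<p = subst (_≢ 0ℚ) (sym (binom-suc y p))
  (*-≢0 (*-≢0 (binom-≢0 y p (λ i i<p → y≢ι<p i (ℕ.m<n⇒m<1+n i<p))) (y≢ι<p p ℕ.≤-refl)) (inv-≢0 (ι-suc≢0 p)))

binom-pascal : ∀ y p → binom (1ℚ + y) (suc p) ≡ binom y p + binom y (suc p)
binom-pascal y p = begin
  falling (1ℚ + y) (suc p) * inv (ι (fact (suc p)))
    ≡⟨ cong (_* inv (ι (fact (suc p)))) (falling-pascal y p) ⟩
  (falling y (suc p) + ι (suc p) * falling y p) * inv (ι (fact (suc p)))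
    ≡⟨ *-distribʳ-+ (inv (ι (fact (suc p)))) (falling y (suc p)) _ ⟩
  binom y (suc p) + ι (suc p) * falling y p * inv (ι (fact (suc p)))
    ≡⟨ cong (λ z → binom y (suc p) + ι (suc p) * falling y p * z) (inv-ι-fact-suc p) ⟩
  binom y (suc p) + ι (suc p) * falling y p * (inv (ι (suc p)) * inv (ι (fact p)))
    ≡⟨ cong (binom y (suc p) +_) (solve 4 (λ s F is f → s :* F :* (is :* f) := F :* f :* (s :* is)) refl (ι (suc p)) (falling y p) (inv (ι (suc p))) (inv (ι (fact p)))) ⟩
  binom y (suc p) + binom y p * (ι (suc p) * inv (ι (suc p)))
    ≡⟨ cong (λ z → binom y (suc p) + binom y p * z) (inv-inverseʳ (ι-suc≢0 p)) ⟩
  binom y (suc p) + binom y p * 1ℚ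
    ≡⟨ trans (cong (binom y (suc p) +_) (*-identityʳ (binom y p))) (+-comm (binom y (suc p)) (binom y p)) ⟩
  binom y p + binom y (suc p)
    ∎

binom-absorb : ∀ y p → ι (suc p) * binom (1ℚ + y) (suc p) ≡ (1ℚ + y) * binom y p
binom-absorb y p = begin
  ι (suc p) * (falling (1ℚ + y) (suc p) * inv (ι (fact (suc p))))
    ≡⟨ cong₂ (λ u v → ι (suc p) * (u * v)) (falling-absorb y p) (inv-ι-fact-suc p) ⟩
  ι (suc p) * ((1ℚ + y) * falling y p * (inv (ι (suc p)) * inv (ι (fact p))))
    ≡⟨ solve 5 (λ s y' F is f → s :* (y' :* F :* (is :* f)) := y' :* (F :* f) :* (s :* is)) refl (ι (suc p)) (1ℚ + y) (falling y p) (inv (ι (suc p))) (inv (ι (fact p))) ⟩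
  (1ℚ + y) * binom y p * (ι (suc p) * inv (ι (suc p)))
    ≡⟨ cong ((1ℚ + y) * binom y p *_) (inv-inverseʳ (ι-suc≢0 p)) ⟩
  (1ℚ + y) * binom y p * 1ℚ
    ≡⟨ *-identityʳ _ ⟩
  (1ℚ + y) * binom y p
    ∎

-- compositions q p = C(q-1, p-1), the number of compositions of q into p positive parts.
compositions : ℕ → ℕ → ℚ
compositions zero    zero    = 1ℚ
compositions zero    (suc p) = 0ℚ
compositions (suc q) zero    = 0ℚ
compositions (suc q) (suc p) = binom (ι q) p

compositions-vanishes : ∀ q p → q < p → compositions q p ≡ 0ℚ
compositions-vanishes zero    (suc p) _         = refl
compositions-vanishes (suc q) (suc p) (s≤s q<p) = binom-vanishes q p q<p

compositions-pascal : ∀ q p → compositions (suc q) (suc p) ≡ compositions q p + compositions q (suc p)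
compositions-pascal zero    zero    = refl
compositions-pascal zero    (suc p) = binom-vanishes 0 (suc p) (s≤s z≤n)
compositions-pascal (suc q) zero    = refl
compositions-pascal (suc q) (suc p) = trans (cong (λ y → binom y (suc p)) (ι-suc q)) (binom-pascal (ι q) p)

compositions-absorb : ∀ m n → ι n * compositions (suc m) (suc n) ≡ ι m * compositions m n
compositions-absorb zero    zero    = refl
compositions-absorb zero    (suc n) = trans (cong (ι (suc n) *_) (binom-vanishes 0 (suc n) (s≤s z≤n))) (*-zeroʳ (ι (suc n)))
compositions-absorb (suc m) zero    = sym (*-zeroʳ (ι (suc m)))
compositions-absorb (suc m) (suc n) = trans (cong (λ y → ι (suc n) * binom y (suc n)) (ι-suc m))
  (trans (binom-absorb (ι m) n) (cong (_* binom (ι m) n) (sym (ι-suc m))))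

hockey-stick : ∀ p m → ∑[ p ≤ q < m ] compositions q p ≡ compositions m (suc p)
hockey-stick p zero    = ∑-empty z≤n
hockey-stick p (suc m) with ℕ.≤-<-connex p m
... | inj₁ p≤m = begin
  ∑[ p ≤ q < suc m ] compositions q p                 ≡⟨ ∑-last p≤m ⟩
  ∑[ p ≤ q < m ] compositions q p + compositions m p  ≡⟨ cong (_+ compositions m p) (hockey-stick p m) ⟩
  compositions m (suc p) + compositions m p           ≡⟨ +-comm (compositions m (suc p)) (compositions m p) ⟩
  compositions m p + compositions m (suc p)           ≡⟨ compositions-pascal m p ⟨
  compositions (suc m) (suc p)                        ∎
... | inj₂ m<p = trans (∑-empty m<p) (sym (compositions-vanishes (suc m) (suc p) (s≤s m<p)))

module SumsBelow (N : ℕ) where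

  compositionSum : (ℕ → ℚ) → ℕ → ℚ
  compositionSum h p = ∑[ p ≤ q < N ] (compositions q p * h q)

  harmonicTail : ℕ → (ℕ → ℚ) → ℕ → ℚ
  harmonicTail zero    g m = g m
  harmonicTail (suc k) g m = ∑[ m ≤ m′ < N ] (inv (ι m′) * harmonicTail k g m′)

  inv-ι-compositionSum : ∀ h n → 0 < n → inv (ι n) * compositionSum h n ≡ compositionSum (harmonicTail 1 h) n
  inv-ι-compositionSum h n 0<n = begin
    inv (ι n) * ∑[ n ≤ m < N ] (compositions m n * h m)
      ≡⟨ *-distribˡ-∑ (inv (ι n)) _ n N ⟩
    ∑[ n ≤ m < N ] (inv (ι n) * (compositions m n * h m))
      ≡⟨ ∑-cong n N (λ m n≤m _ → pointwise m n≤m) ⟩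
    ∑[ n ≤ m < N ] ∑[ n ≤ q < suc m ] (compositions q n * (inv (ι m) * h m))
      ≡⟨ ∑-swap-≤ (λ q m → compositions q n * (inv (ι m) * h m)) n N ⟨
    ∑[ n ≤ q < N ] ∑[ q ≤ m < N ] (compositions q n * (inv (ι m) * h m))
      ≡⟨ ∑-cong n N (λ q _ _ → *-distribˡ-∑ (compositions q n) _ q N) ⟨
    ∑[ n ≤ q < N ] (compositions q n * ∑[ q ≤ m < N ] (inv (ι m) * h m))
      ∎
    where
    pointwise : ∀ m → n ≤ m → inv (ι n) * (compositions m n * h m) ≡ ∑[ n ≤ q < suc m ] (compositions q n * (inv (ι m) * h m))
    pointwise m n≤m = begin
      inv (ι n) * (compositions m n * h m)                     ≡⟨ *-assoc (inv (ι n)) _ _ ⟨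
      inv (ι n) * compositions m n * h m                       ≡⟨ cong (_* h m) (inv-cross (ι-≢0 (ℕ.<-≤-trans 0<n n≤m)) (ι-≢0 0<n) (sym (compositions-absorb m n))) ⟩
      inv (ι m) * compositions (suc m) (suc n) * h m           ≡⟨ cong (λ c → inv (ι m) * c * h m) (hockey-stick n (suc m)) ⟨
      inv (ι m) * ∑[ n ≤ q < suc m ] compositions q n * h m    ≡⟨ solve 3 (λ i c g → i :* c :* g := i :* g :* c) refl (inv (ι m)) _ (h m) ⟩
      inv (ι m) * h m * ∑[ n ≤ q < suc m ] compositions q n    ≡⟨ *-distribˡ-∑ (inv (ι m) * h m) _ n (suc m) ⟩
      ∑[ n ≤ q < suc m ] (inv (ι m) * h m * compositions q n)  ≡⟨ ∑-cong n (suc m) (λ q _ _ → *-comm (inv (ι m) * h m) _) ⟩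
      ∑[ n ≤ q < suc m ] (compositions q n * (inv (ι m) * h m)) ∎

  inv-pow-compositionSum : ∀ k h n → 0 < n → inv (pow (ι n) k) * compositionSum h n ≡ compositionSum (harmonicTail k h) n
  inv-pow-compositionSum zero    h n _   = *-identityˡ (compositionSum h n)
  inv-pow-compositionSum (suc k) h n 0<n = begin
    inv (ι n * pow (ι n) k) * compositionSum h n         ≡⟨ cong (_* compositionSum h n) (inv-distrib-* (ι n) (pow (ι n) k)) ⟩
    inv (ι n) * inv (pow (ι n) k) * compositionSum h n   ≡⟨ *-assoc (inv (ι n)) _ _ ⟩
    inv (ι n) * (inv (pow (ι n) k) * compositionSum h n) ≡⟨ cong (inv (ι n) *_) (inv-pow-compositionSum k h n 0<n) ⟩
    inv (ι n) * compositionSum (harmonicTail k h) n      ≡⟨ inv-ι-compositionSum (harmonicTail k h) n 0<n ⟩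
    compositionSum (harmonicTail (suc k) h) n            ∎

  compositionSum-zero : ∀ h → 0 < N → compositionSum h 0 ≡ h 0
  compositionSum-zero h 0<N = begin
    ∑[ 0 ≤ q < N ] (compositions q 0 * h q)                            ≡⟨ ∑-head 0<N ⟩
    compositions 0 0 * h 0 + ∑[ 1 ≤ q < N ] (compositions q 0 * h q)  ≡⟨ cong (compositions 0 0 * h 0 +_) (∑-zero 1 N λ { (suc q) _ _ → *-zeroˡ (h (suc q)) }) ⟩
    1ℚ * h 0 + 0ℚ                                                      ≡⟨ trans (+-identityʳ (1ℚ * h 0)) (*-identityˡ (h 0)) ⟩
    h 0                                                                ∎

  compositionSum-tail : ∀ g p → compositionSum (λ q → ∑[ suc q ≤ m < N ] g m) p ≡ compositionSum g (suc p)
  compositionSum-tail g p = begin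
    ∑[ p ≤ q < N ] (compositions q p * ∑[ suc q ≤ m < N ] g m)  ≡⟨ ∑-cong p N (λ q _ _ → *-distribˡ-∑ (compositions q p) g (suc q) N) ⟩
    ∑[ p ≤ q < N ] ∑[ suc q ≤ m < N ] (compositions q p * g m)  ≡⟨ ∑-swap-< (λ q m → compositions q p * g m) p N ⟩
    ∑[ suc p ≤ m < N ] ∑[ p ≤ q < m ] (compositions q p * g m)  ≡⟨ ∑-cong (suc p) N (λ m _ _ → pointwise m) ⟩
    ∑[ suc p ≤ m < N ] (compositions m (suc p) * g m)           ∎
    where
    pointwise : ∀ m → ∑[ p ≤ q < m ] (compositions q p * g m) ≡ compositions m (suc p) * g m
    pointwise m = begin
      ∑[ p ≤ q < m ] (compositions q p * g m)  ≡⟨ ∑-cong p m (λ q _ _ → *-comm (compositions q p) (g m)) ⟩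
      ∑[ p ≤ q < m ] (g m * compositions q p)  ≡⟨ *-distribˡ-∑ (g m) _ p m ⟨
      g m * ∑[ p ≤ q < m ] compositions q p    ≡⟨ cong (g m *_) (hockey-stick p m) ⟩
      g m * compositions m (suc p)             ≡⟨ *-comm (g m) _ ⟩
      compositions m (suc p) * g m             ∎

  sumL-weakSeqs-suc : ∀ k lo (F : List ℕ → ℚ) →
    sumL (map F (weakSeqs (suc k) lo N)) ≡ ∑[ lo ≤ m < N ] sumL (map (F ∘ (m ∷_)) (weakSeqs k m N))
  sumL-weakSeqs-suc k lo F = begin
    sumL (map F (concatMap (λ m → map (m ∷_) (weakSeqs k m N)) (range lo N)))
      ≡⟨ sumL-concatMap F (λ m → map (m ∷_) (weakSeqs k m N)) (range lo N) ⟩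
    sumL (map (λ m → sumL (map F (map (m ∷_) (weakSeqs k m N)))) (range lo N))
      ≡⟨ cong sumL (map-cong (λ m → cong sumL (map-∘ (weakSeqs k m N))) (range lo N)) ⟨
    sumL (map (λ m → sumL (map (F ∘ (m ∷_)) (weakSeqs k m N))) (range lo N))
      ≡⟨ sumL-range lo N _ ⟩
    ∑[ lo ≤ m < N ] sumL (map (F ∘ (m ∷_)) (weakSeqs k m N))
      ∎

  -- The product of the tail entries is local to blockTerm, so it is left to unification.
  blockTerm-cons : ∀ x m b bs → blockTerm N x (m ∷ b ∷ bs) ≡ inv (ι b) * blockTerm N x (m ∷ bs)
  blockTerm-cons x m b bs = factor-out (ι m - ι N * x) (ι b) _
    where
    factor-out : ∀ c e d → inv (c * (e * d)) ≡ inv e * inv (c * d)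
    factor-out c e d = trans (cong inv (solve 3 (λ c e d → c :* (e :* d) := e :* (c :* d)) refl c e d)) (inv-distrib-* e (c * d))

  sumL-blockTerm≡harmonicTail : ∀ x k m₁ (g : ℕ → ℚ) n →
    sumL (map (λ ms → blockTerm N x (m₁ ∷ ms) * g (lastOr n ms)) (weakSeqs k n N))
      ≡ inv (ι m₁ - ι N * x) * harmonicTail k g n
  sumL-blockTerm≡harmonicTail x zero    m₁ g n = trans (+-identityʳ _) (cong (λ c → inv c * g n) (*-identityʳ (ι m₁ - ι N * x)))
  sumL-blockTerm≡harmonicTail x (suc k) m₁ g n = begin
    sumL (map (λ ms → blockTerm N x (m₁ ∷ ms) * g (lastOr n ms)) (weakSeqs (suc k) n N))
      ≡⟨ sumL-weakSeqs-suc k n _ ⟩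
    ∑[ n ≤ m < N ] sumL (map (λ ms → blockTerm N x (m₁ ∷ m ∷ ms) * g (lastOr m ms)) (weakSeqs k m N))
      ≡⟨ ∑-cong n N (λ m _ _ → inner m) ⟩
    ∑[ n ≤ m < N ] (c * (inv (ι m) * harmonicTail k g m))
      ≡⟨ *-distribˡ-∑ c _ n N ⟨
    c * harmonicTail (suc k) g n
      ∎
    where
    c : ℚ
    c = inv (ι m₁ - ι N * x)
    inner : ∀ m → sumL (map (λ ms → blockTerm N x (m₁ ∷ m ∷ ms) * g (lastOr m ms)) (weakSeqs k m N))
                ≡ c * (inv (ι m) * harmonicTail k g m)
    inner m = begin
      sumL (map (λ ms → blockTerm N x (m₁ ∷ m ∷ ms) * g (lastOr m ms)) (weakSeqs k m N))
        ≡⟨ cong sumL (map-cong (λ ms → trans (cong (_* g (lastOr m ms)) (blockTerm-cons x m₁ m ms)) (*-assoc (inv (ι m)) _ _)) (weakSeqs k m N)) ⟩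
      sumL (map (λ ms → inv (ι m) * (blockTerm N x (m₁ ∷ ms) * g (lastOr m ms))) (weakSeqs k m N))
        ≡⟨ *-distribˡ-sumL (inv (ι m)) _ (weakSeqs k m N) ⟨
      inv (ι m) * sumL (map (λ ms → blockTerm N x (m₁ ∷ ms) * g (lastOr m ms)) (weakSeqs k m N))
        ≡⟨ cong (inv (ι m) *_) (sumL-blockTerm≡harmonicTail x k m₁ g m) ⟩
      inv (ι m) * (c * harmonicTail k g m)
        ≡⟨ solve 3 (λ i c h → i :* (c :* h) := c :* (i :* h)) refl (inv (ι m)) c (harmonicTail k g m) ⟩
      c * (inv (ι m) * harmonicTail k g m)
        ∎

  rhsSum-cons : ∀ {r} x k (ks : Vec ℕ r) xs lo →
    rhsSum N (suc k ∷ ks) (x ∷ xs) lo ≡ ∑[ lo ≤ m < N ] (inv (ι m - ι N * x) * harmonicTail k (λ j → rhsSum N ks xs (suc j)) m)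
  rhsSum-cons x k ks xs lo = trans (sumL-weakSeqs-suc k lo _) (∑-cong lo N (λ m _ _ → sumL-blockTerm≡harmonicTail x k m (λ j → rhsSum N ks xs (suc j)) m))

module PartialFractions (N : ℕ) (a : ℚ) (a≢ι : ∀ n → 0 < n → n < N → a ≢ ι n) where

  open SumsBelow N

  y : ℚ
  y = a - 1ℚ

  a-ι≢0 : ∀ {q} → 0 < q → q < N → a - ι q ≢ 0ℚ
  a-ι≢0 {q} 0<q q<N = -≢0 (a≢ι q 0<q q<N)

  y-ι≢0 : ∀ {i} → suc i < N → y - ι i ≢ 0ℚ
  y-ι≢0 {i} 1+i<N = subst (_≢ 0ℚ) a-ι[1+i]≡y-ιi (a-ι≢0 (s≤s z≤n) 1+i<N)
    where
    a-ι[1+i]≡y-ιi : a - ι (suc i) ≡ y - ι i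
    a-ι[1+i]≡y-ιi = trans (cong (λ e → a - e) (ι-suc i)) (solve 2 (λ a u → a :- (con 1ℚ :+ u) := a :- con 1ℚ :- u) refl a (ι i))

  summand : ℕ → ℕ → ℚ
  summand q n = inv (binom y n) * inv (ι n) * compositions q n

  antidifference : ℕ → ℕ → ℚ
  antidifference q n = compositions q (suc n) * inv (binom y n) * inv (a - ι q)

  summand≡Δantidifference : ∀ q n → n < q → q < N → summand q (suc n) + antidifference q (suc n) ≡ antidifference q n
  summand≡Δantidifference (suc q) n n<q q<N = begin
    inv (binom y (suc n)) * inv s * c + c′ * inv (binom y (suc n)) * v
      ≡⟨ cong (λ G → G * inv s * c + c′ * G * v) (inv-binom-suc y n) ⟩
    g * s * u * inv s * c + c′ * (g * s * u) * v
      ≡⟨ solve 7 (λ g s u is c c′ v → g :* s :* u :* is :* c :+ c′ :* (g :* s :* u) :* v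
                                   := g :* u :* (c :* (s :* is) :+ v :* (s :* c′))) refl g s u (inv s) c c′ v ⟩
    g * u * (c * (s * inv s) + v * (s * c′))
      ≡⟨ cong₂ (λ e f → g * u * (c * e + v * f)) (inv-inverseʳ (ι-suc≢0 n)) (binom-suc′ (ι q) n) ⟩
    g * u * (c * 1ℚ + v * (c * (ι q - ι n)))
      ≡⟨ cong (λ e → g * u * (c * e + v * (c * (ι q - ι n)))) (inv-inverseˡ (a-ι≢0 (s≤s z≤n) q<N)) ⟨
    g * u * (c * (v * (a - ι (suc q))) + v * (c * (ι q - ι n)))
      ≡⟨ cong (λ e → g * u * (c * (v * (a - e)) + v * (c * (ι q - ι n)))) (ι-suc q) ⟩
    g * u * (c * (v * (a - (1ℚ + ι q))) + v * (c * (ι q - ι n)))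
      ≡⟨ solve 7 (λ g u c v a q n → g :* u :* (c :* (v :* (a :- (con 1ℚ :+ q))) :+ v :* (c :* (q :- n)))
                                 := c :* g :* v :* (u :* (a :- con 1ℚ :- n))) refl g u c v a (ι q) (ι n) ⟩
    c * g * v * (u * (y - ι n))
      ≡⟨ cong (c * g * v *_) (inv-inverseˡ (y-ι≢0 (ℕ.≤-<-trans n<q q<N))) ⟩
    c * g * v * 1ℚ
      ≡⟨ *-identityʳ (c * g * v) ⟩
    c * g * v
      ∎
    where
    g s u v c c′ : ℚ
    g  = inv (binom y n)
    s  = ι (suc n)
    u  = inv (y - ι n)
    v  = inv (a - ι (suc q))
    c  = binom (ι q) n
    c′ = binom (ι q) (suc n)

  partialFractions : ∀ p q → p ≤ q → q < N → ∑[ suc p ≤ n < suc q ] summand q n ≡ antidifference q p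
  partialFractions p q p≤q q<N = begin
    ∑[ suc p ≤ n < suc q ] summand q n                       ≡⟨ +-identityʳ _ ⟨
    ∑[ suc p ≤ n < suc q ] summand q n + 0ℚ                  ≡⟨ cong (∑[ suc p ≤ n < suc q ] summand q n +_) antidifference-top ⟨
    ∑[ suc p ≤ n < suc q ] summand q n + antidifference q q  ≡⟨ ∑-telescope p q p≤q (λ n _ n<q → summand≡Δantidifference q n n<q q<N) ⟩
    antidifference q p                                       ∎
    where
    antidifference-top : antidifference q q ≡ 0ℚ
    antidifference-top = begin
      compositions q (suc q) * inv (binom y q) * inv (a - ι q) ≡⟨ cong (λ c → c * inv (binom y q) * inv (a - ι q)) (compositions-vanishes q (suc q) ℕ.≤-refl) ⟩
      0ℚ * inv (binom y q) * inv (a - ι q)                     ≡⟨ solve 2 (λ g v → con 0ℚ :* g :* v := con 0ℚ) refl (inv (binom y q)) (inv (a - ι q)) ⟩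
      0ℚ                                                       ∎

  ∑-binomRatio-compositionSum : ∀ h p →
    ∑[ suc p ≤ n < N ] (binom y p * inv (binom y n) * inv (ι n) * compositionSum h n)
      ≡ - compositionSum (λ q → inv (ι q - a) * h q) (suc p)
  ∑-binomRatio-compositionSum h p = begin
    ∑[ suc p ≤ n < N ] (w n * ∑[ n ≤ q < N ] (compositions q n * h q))
      ≡⟨ ∑-cong (suc p) N (λ n _ _ → *-distribˡ-∑ (w n) _ n N) ⟩
    ∑[ suc p ≤ n < N ] ∑[ n ≤ q < N ] (w n * (compositions q n * h q))
      ≡⟨ ∑-swap-≤ (λ n q → w n * (compositions q n * h q)) (suc p) N ⟩
    ∑[ suc p ≤ q < N ] ∑[ suc p ≤ n < suc q ] (w n * (compositions q n * h q))
      ≡⟨ ∑-cong (suc p) N (λ q p<q q<N → pointwise q p<q q<N) ⟩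
    ∑[ suc p ≤ q < N ] (- 1ℚ * (compositions q (suc p) * (inv (ι q - a) * h q)))
      ≡⟨ *-distribˡ-∑ (- 1ℚ) _ (suc p) N ⟨
    - 1ℚ * compositionSum (λ q → inv (ι q - a) * h q) (suc p)
      ≡⟨ solve 1 (λ z → con (- 1ℚ) :* z := :- z) refl _ ⟩
    - compositionSum (λ q → inv (ι q - a) * h q) (suc p)
      ∎
    where
    w : ℕ → ℚ
    w n = binom y p * inv (binom y n) * inv (ι n)
    pointwise : ∀ q → suc p ≤ q → q < N →
      ∑[ suc p ≤ n < suc q ] (w n * (compositions q n * h q)) ≡ - 1ℚ * (compositions q (suc p) * (inv (ι q - a) * h q))
    pointwise q p<q q<N = begin
      ∑[ suc p ≤ n < suc q ] (w n * (compositions q n * h q))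
        ≡⟨ ∑-cong (suc p) (suc q) (λ n _ _ → solve 5 (λ b g i c x → b :* g :* i :* (c :* x) := x :* b :* (g :* i :* c)) refl (binom y p) (inv (binom y n)) (inv (ι n)) (compositions q n) (h q)) ⟩
      ∑[ suc p ≤ n < suc q ] (h q * binom y p * summand q n)
        ≡⟨ *-distribˡ-∑ (h q * binom y p) (summand q) (suc p) (suc q) ⟨
      h q * binom y p * ∑[ suc p ≤ n < suc q ] summand q n
        ≡⟨ cong (h q * binom y p *_) (partialFractions p q (ℕ.<⇒≤ p<q) q<N) ⟩
      h q * binom y p * (compositions q (suc p) * inv (binom y p) * inv (a - ι q))
        ≡⟨ solve 5 (λ x b c g v → x :* b :* (c :* g :* v) := c :* v :* x :* (b :* g)) refl (h q) (binom y p) (compositions q (suc p)) (inv (binom y p)) (inv (a - ι q)) ⟩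
      compositions q (suc p) * inv (a - ι q) * h q * (binom y p * inv (binom y p))
        ≡⟨ cong (compositions q (suc p) * inv (a - ι q) * h q *_) (inv-inverseʳ (binom-≢0 y p (λ i i<p → y-ι≢0 (ℕ.≤-<-trans i<p (ℕ.<-trans p<q q<N))))) ⟩
      compositions q (suc p) * inv (a - ι q) * h q * 1ℚ
        ≡⟨ cong (λ e → compositions q (suc p) * inv e * h q * 1ℚ) (solve 2 (λ a q → a :- q := :- (q :- a)) refl a (ι q)) ⟩
      compositions q (suc p) * inv (- (ι q - a)) * h q * 1ℚ
        ≡⟨ cong (λ e → compositions q (suc p) * e * h q * 1ℚ) (inv-neg (ι q - a)) ⟩
      compositions q (suc p) * - inv (ι q - a) * h q * 1ℚ
        ≡⟨ solve 3 (λ c v x → c :* (:- v) :* x :* con 1ℚ := con (- 1ℚ) :* (c :* (v :* x))) refl (compositions q (suc p)) (inv (ι q - a)) (h q) ⟩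
      - 1ℚ * (compositions q (suc p) * (inv (ι q - a) * h q))
        ∎

module Identity (M : ℕ) where

  N : ℕ
  N = suc M

  open SumsBelow N

  ShiftedIdentity : ∀ {r} → Vec ℕ r → Vec ℚ r → Set
  ShiftedIdentity {r} ks xs = ∀ p →
    binom (ι N * headOr1 xs - 1ℚ) p * lhsSum N ks xs (suc p) ≡ pow (- 1ℚ) r * compositionSum (λ q → rhsSum N ks xs (suc q)) p

  shiftedIdentity-[] : ShiftedIdentity [] []
  shiftedIdentity-[] p = begin
    binom (ι N * 1ℚ - 1ℚ) p * 1ℚ                 ≡⟨ *-identityʳ _ ⟩
    binom (ι N * 1ℚ - 1ℚ) p                      ≡⟨ cong (λ z → binom z p) N-1≡M ⟩
    compositions N (suc p)                       ≡⟨ hockey-stick p N ⟨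
    ∑[ p ≤ q < N ] compositions q p              ≡⟨ ∑-cong p N (λ q _ _ → *-identityʳ (compositions q p)) ⟨
    ∑[ p ≤ q < N ] (compositions q p * 1ℚ)       ≡⟨ *-identityˡ _ ⟨
    1ℚ * ∑[ p ≤ q < N ] (compositions q p * 1ℚ)  ∎
    where
    N-1≡M : ι N * 1ℚ - 1ℚ ≡ ι M
    N-1≡M = trans (cong (λ n → n * 1ℚ - 1ℚ) (ι-suc M)) (solve 1 (λ m → (con 1ℚ :+ m) :* con 1ℚ :- con 1ℚ := m) refl (ι M))

  shiftedIdentity-∷ : ∀ {r} k (ks : Vec ℕ r) x xs → (∀ n → 0 < n → n < N → ι N * x ≢ ι n) →
    ShiftedIdentity ks xs → ShiftedIdentity (suc k ∷ ks) (x ∷ xs)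
  shiftedIdentity-∷ {r} k ks x xs Nx≢ι IH p = begin
    binom y p * lhsSum N (suc k ∷ ks) (x ∷ xs) (suc p)
      ≡⟨ cong (binom y p *_) (sumL-range (suc p) N _) ⟩
    binom y p * ∑[ suc p ≤ n < N ] (inv (pow (ι n) (suc k)) * (B n * inv (binom y n)) * ℓ n)
      ≡⟨ *-distribˡ-∑ (binom y p) _ (suc p) N ⟩
    ∑[ suc p ≤ n < N ] (binom y p * (inv (pow (ι n) (suc k)) * (B n * inv (binom y n)) * ℓ n))
      ≡⟨ ∑-cong (suc p) N (λ n p<n _ → pointwise n (ℕ.<-≤-trans (s≤s z≤n) p<n)) ⟩
    ∑[ suc p ≤ n < N ] (s * (binom y p * inv (binom y n) * inv (ι n) * compositionSum (harmonicTail k ρ) n))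
      ≡⟨ *-distribˡ-∑ s _ (suc p) N ⟨
    s * ∑[ suc p ≤ n < N ] (binom y p * inv (binom y n) * inv (ι n) * compositionSum (harmonicTail k ρ) n)
      ≡⟨ cong (s *_) (∑-binomRatio-compositionSum (harmonicTail k ρ) p) ⟩
    s * - compositionSum (λ m → inv (ι m - ι N * x) * harmonicTail k ρ m) (suc p)
      ≡⟨ cong (λ e → s * - e) (compositionSum-tail (λ m → inv (ι m - ι N * x) * harmonicTail k ρ m) p) ⟨
    s * - compositionSum (λ q → ∑[ suc q ≤ m < N ] (inv (ι m - ι N * x) * harmonicTail k ρ m)) p
      ≡⟨ cong (λ e → s * - e) (∑-cong p N (λ q _ _ → cong (compositions q p *_) (rhsSum-cons x k ks xs (suc q)))) ⟨
    s * - compositionSum (λ q → rhsSum N (suc k ∷ ks) (x ∷ xs) (suc q)) p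
      ≡⟨ solve 2 (λ s z → s :* (:- z) := (:- con 1ℚ) :* s :* z) refl s _ ⟩
    pow (- 1ℚ) (suc r) * compositionSum (λ q → rhsSum N (suc k ∷ ks) (x ∷ xs) (suc q)) p
      ∎
    where
    open PartialFractions N (ι N * x) Nx≢ι
    s : ℚ
    s = pow (- 1ℚ) r
    B ℓ ρ : ℕ → ℚ
    B n = binom (ι N * headOr1 xs - 1ℚ) n
    ℓ n = lhsSum N ks xs (suc n)
    ρ q = rhsSum N ks xs (suc q)
    pointwise : ∀ n → 0 < n →
      binom y p * (inv (pow (ι n) (suc k)) * (B n * inv (binom y n)) * ℓ n)
        ≡ s * (binom y p * inv (binom y n) * inv (ι n) * compositionSum (harmonicTail k ρ) n)
    pointwise n 0<n = begin
      binom y p * (inv (ι n * pow (ι n) k) * (B n * inv (binom y n)) * ℓ n)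
        ≡⟨ cong (λ e → binom y p * (e * (B n * inv (binom y n)) * ℓ n)) (inv-distrib-* (ι n) (pow (ι n) k)) ⟩
      binom y p * (inv (ι n) * inv (pow (ι n) k) * (B n * inv (binom y n)) * ℓ n)
        ≡⟨ solve 6 (λ b i ip B g l → b :* (i :* ip :* (B :* g) :* l) := b :* g :* i :* (ip :* (B :* l))) refl (binom y p) (inv (ι n)) (inv (pow (ι n) k)) (B n) (inv (binom y n)) (ℓ n) ⟩
      w * (inv (pow (ι n) k) * (B n * ℓ n))
        ≡⟨ cong (λ e → w * (inv (pow (ι n) k) * e)) (IH n) ⟩
      w * (inv (pow (ι n) k) * (s * compositionSum ρ n))
        ≡⟨ solve 4 (λ w ip s c → w :* (ip :* (s :* c)) := s :* (w :* (ip :* c))) refl w (inv (pow (ι n) k)) s (compositionSum ρ n) ⟩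
      s * (w * (inv (pow (ι n) k) * compositionSum ρ n))
        ≡⟨ cong (λ e → s * (w * e)) (inv-pow-compositionSum k ρ n 0<n) ⟩
      s * (w * compositionSum (harmonicTail k ρ) n)
        ∎
      where
      w : ℚ
      w = binom y p * inv (binom y n) * inv (ι n)

  shiftedIdentity : ∀ {r} (ks : Vec ℕ r) xs → All (0 <_) ks →
    ((i : Fin r) (n : ℕ) → 0 < n → n < N → ι N * lookup xs i ≢ ι n) → ShiftedIdentity ks xs
  shiftedIdentity []           []       []          _           = shiftedIdentity-[]
  shiftedIdentity (suc k ∷ ks) (x ∷ xs) (_ ∷ 0<ks) nonResonant =
    shiftedIdentity-∷ k ks x xs (nonResonant zero) (shiftedIdentity ks xs 0<ks (nonResonant ∘ suc))

theorem1p2 : (r : ℕ) (k : Vec ℕ r) → All (0 <_) k →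
    (x : Vec ℚ r) → (N : ℕ) → 0 < N →
    ((i : Fin r) (n : ℕ) → 0 < n → n < N → ι N * lookup x i ≢ ι n) →
    LHS N k x ≡ RHS N k x
theorem1p2 r k 0<k x (suc M) 0<N nonResonant = begin
  lhsSum N k x 1                                                   ≡⟨ *-identityˡ _ ⟨
  binom (ι N * headOr1 x - 1ℚ) 0 * lhsSum N k x 1                  ≡⟨ shiftedIdentity k x 0<k nonResonant 0 ⟩
  pow (- 1ℚ) r * compositionSum (λ q → rhsSum N k x (suc q)) 0     ≡⟨ cong (pow (- 1ℚ) r *_) (compositionSum-zero _ 0<N) ⟩
  pow (- 1ℚ) r * rhsSum N k x 1                                    ∎
  where
  open Identity M
  open SumsBelow N
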